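{- Let $G$ be a connected graph with $n$ vertices and diameter $d$. Then (i) $o(G)\le 2^d$; (ii) $2^d\le c_r(G)$; (iii) $c_r(G)\le c_g(G)$; (iv) $o(G)\le c_u(G)$; (v) $c_u(G)\le n$; (vi) $n\le c_g(G)$; (vii) $c_g(G)\le p(G)$.
   Context: A pebbling distribution $D$ on a connected graph $G$ assigns to each vertex $a$ a non-negative integer $D(a)$ of pebbles; its size is $|D|=\sum_a D(a)$. A pebbling step $[a,b]$, for adjacent vertices $a,b$, removes two pebbles from $a$ and adds one pebble to $b$. $D$ is $r$-solvable if some sequence of pebbling steps from $D$ ends with at least one pebble on $r$; $D$ is solvable if it is $r$-solvable for every vertex $r$, unsolvable otherwise. A rooted distribution is a distribution with a fixed root $r$. A rooted distribution is minimally $r$-solvable if it is $r$-solvable but removing any one pebble makes it not $r$-solvable. A distribution is minimally solvable if it is solvable but removing any one pebble makes it unsolvable; it is maximally unsolvable if it is unsolvable but adding any one pebble makes it solvable. Define: $p(G)$ = the minimum number such that every distribution with $p(G)$ pebbles is solvable (the pebbling number); $o(G)$ = the smallest size of a minimally solvable distribution (optimal pebbling number); $c_g(G)$ = the largest size of a minimally solvable distribution; $c_r(G)$ = the largest size of a minimally $r$-solvable rooted distribution, over all roots $r$; $c_u(G)$ = one more than the smallest size of a maximally unsolvable distribution. -}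

module Defs where

open import Data.Nat using (ℕ; zero; suc; _+_; _∸_; _≤_; _^_)
open import Data.Fin using (Fin)
open import Data.Vec.Functional using (Vector; updateAt; foldr)
open import Data.Product using (Σ; ∃; ∃-syntax; _×_; _,_)
open import Relation.Nullary using (¬_)
open import Relation.Binary.PropositionalEquality using (_≡_; _≢_)
open import Relation.Binary.Construct.Closure.ReflexiveTransitive using (Star)

record Graph (n : ℕ) : Set₁ where
  field
    Adj     : Fin n → Fin n → Set
    sym     : ∀ {a b} → Adj a b → Adj b a
    irrefl  : ∀ {a} → ¬ Adj a a
open Graph public

data Walk {n : ℕ} (G : Graph n) : Fin n → Fin n → ℕ → Set where
  here : ∀ {u} → Walk G u u 0
  step : ∀ {u w v k} → Adj G u w → Walk G w v k → Walk G u v (suc k)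

Connected : ∀ {n} → Graph n → Set
Connected G = ∀ u v → ∃[ k ] Walk G u v k

IsMinimum : (ℕ → Set) → ℕ → Set
IsMinimum P k = P k × (∀ m → P m → k ≤ m)

IsMaximum : (ℕ → Set) → ℕ → Set
IsMaximum P k = P k × (∀ m → P m → m ≤ k)

IsDistance : ∀ {n} → Graph n → Fin n → Fin n → ℕ → Set
IsDistance G u v = IsMinimum (Walk G u v)

IsDiameter : ∀ {n} → Graph n → ℕ → Set
IsDiameter G = IsMaximum (λ k → ∃[ u ] ∃[ v ] IsDistance G u v k)

Distribution : ℕ → Set
Distribution n = Vector ℕ n

size : ∀ {n} → Distribution n → ℕ
size D = foldr _+_ 0 D

pebble : ∀ {n} → Distribution n → Fin n → Fin n → Distribution n
pebble D a b = updateAt (updateAt D a (λ k → k ∸ 2)) b suc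

PebblingStep : ∀ {n} → Graph n → Distribution n → Distribution n → Set
PebblingStep G D E =
  ∃[ a ] ∃[ b ] (Adj G a b × 2 ≤ D a × E ≡ pebble D a b)

Reachable : ∀ {n} → Graph n → Distribution n → Distribution n → Set
Reachable G = Star (PebblingStep G)

RootSolvable : ∀ {n} → Graph n → Fin n → Distribution n → Set
RootSolvable G r D = ∃[ E ] (Reachable G D E × 1 ≤ E r)

Solvable : ∀ {n} → Graph n → Distribution n → Set
Solvable G D = ∀ r → RootSolvable G r D

Unsolvable : ∀ {n} → Graph n → Distribution n → Set
Unsolvable G D = ¬ Solvable G D

removePebble : ∀ {n} → Distribution n → Fin n → Distribution n
removePebble D v = updateAt D v (λ k → k ∸ 1)

addPebble : ∀ {n} → Distribution n → Fin n → Distribution n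
addPebble D v = updateAt D v suc

MinimallyRootSolvable : ∀ {n} → Graph n → Fin n → Distribution n → Set
MinimallyRootSolvable G r D =
  RootSolvable G r D × (∀ v → 1 ≤ D v → ¬ RootSolvable G r (removePebble D v))

MinimallySolvable : ∀ {n} → Graph n → Distribution n → Set
MinimallySolvable G D =
  Solvable G D × (∀ v → 1 ≤ D v → Unsolvable G (removePebble D v))

MaximallyUnsolvable : ∀ {n} → Graph n → Distribution n → Set
MaximallyUnsolvable G D =
  Unsolvable G D × (∀ v → Solvable G (addPebble D v))

IsPebblingNumber : ∀ {n} → Graph n → ℕ → Set
IsPebblingNumber G =
  IsMinimum (λ m → ∀ D → size D ≡ m → Solvable G D)

IsOptimalPebblingNumber : ∀ {n} → Graph n → ℕ → Set
IsOptimalPebblingNumber G =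
  IsMinimum (λ s → ∃[ D ] (MinimallySolvable G D × size D ≡ s))

IsCg : ∀ {n} → Graph n → ℕ → Set
IsCg G =
  IsMaximum (λ s → ∃[ D ] (MinimallySolvable G D × size D ≡ s))

IsCr : ∀ {n} → Graph n → ℕ → Set
IsCr G =
  IsMaximum (λ s → ∃[ r ] ∃[ D ] (MinimallyRootSolvable G r D × size D ≡ s))

IsCu : ∀ {n} → Graph n → ℕ → Set
IsCu G k =
  ∃[ m ] (IsMinimum (λ s → ∃[ D ] (MaximallyUnsolvable G D × size D ≡ s)) m
          × k ≡ suc m)

-- Most of the bounds come from explicit distributions: 2^d pebbles on one end u of a
-- diametral pair (solvable, and minimally solvable for the other end v), one pebble on
-- every vertex (minimally solvable), and one pebble on every vertex except u (maximally
-- unsolvable, since an extra pebble anywhere can be pushed along a shortest path to u).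
-- Minimality of the pile of 2^d is a weight argument: with h the distance from u, the
-- weight Σ D(y) 2^h(y) never increases under a pebbling step, and 2^d - 1 pebbles on u
-- weigh less than one pebble on v. A minimally r-solvable D becomes minimally solvable
-- after adding one pebble on each vertex D cannot reach: those pebbles can never move,
-- because their vertices never receive a second pebble. Finally c_g ≤ p, since a
-- minimally solvable distribution with more than p pebbles would stay solvable after
-- losing one.
-- Distances and minimal solvable subdistributions exist only classically here, so they
-- are used under double negation; this suffices because every conclusion is a decidable
-- inequality.
module Submission where

open import Defs
open import Data.Nat using (ℕ; zero; suc; _+_; _*_; _∸_; _≤_; _<_; _^_; z≤n; s≤s; _≤?_)
open import Data.Nat.Properties hiding (_≟_)
open import Data.Nat.Induction using (<-rec)
open import Data.Bool using (if_then_else_)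
open import Data.Fin using (Fin; zero; suc; _≟_)
open import Data.Fin.Properties using () renaming (suc-injective to Fin-suc-injective)
open import Data.Vec.Functional using (updateAt; zipWith; tail)
open import Data.Vec.Functional.Properties using (updateAt-updates; updateAt-minimal; updateAt-updateAt)
open import Data.Empty using (⊥)
open import Data.Product using (∃; _×_; _,_; proj₁; proj₂)
open import Effect.Monad using (RawMonad)
open import Function using (_∘_; case_of_)
open import Level using (0ℓ)
open import Relation.Nullary using (¬_; Dec; yes; no; does; contradiction)
open import Relation.Nullary.Decidable using (decidable-stable; ¬¬-excluded-middle)
open import Relation.Nullary.Negation using (¬¬-Monad)
open import Relation.Binary.PropositionalEquality as ≡ using (_≡_; _≢_; _≗_; refl; cong; cong₂; subst; subst₂)
open import Relation.Binary.Construct.Closure.ReflexiveTransitive using (ε; _◅_; _◅◅_)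

open RawMonad (¬¬-Monad {0ℓ}) using (_>>=_; pure)

private
  variable
    n k : ℕ

¬¬-Π-Fin : {P : Fin n → Set} → (∀ i → ¬ ¬ P i) → ¬ ¬ (∀ i → P i)
¬¬-Π-Fin {zero} _ = pure λ ()
¬¬-Π-Fin {suc n} ¬¬P = do
  p₀ ← ¬¬P zero
  ps ← ¬¬-Π-Fin (¬¬P ∘ suc)
  pure λ { zero → p₀ ; (suc i) → ps i }

¬¬-minimum : (P : ℕ → Set) → P k → ¬ ¬ ∃ (IsMinimum P)
¬¬-minimum P = <-rec (λ k → P k → ¬ ¬ ∃ (IsMinimum P)) search _
  where
  search : ∀ k → (∀ {m} → m < k → P m → ¬ ¬ ∃ (IsMinimum P)) → P k → ¬ ¬ ∃ (IsMinimum P)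
  search k below pk = do
    smaller? ← ¬¬-excluded-middle {A = ∃ λ m → m < k × P m}
    case smaller? of λ where
      (yes (m , m<k , pm)) → below m<k pm
      (no none) → pure (k , pk , λ m pm → ≮⇒≥ λ m<k → none (m , m<k , pm))

-- Distributions

infix 4 _≤ᵈ_

_≤ᵈ_ : Distribution n → Distribution n → Set
D ≤ᵈ E = ∀ i → D i ≤ E i

pile : Fin n → ℕ → Distribution n
pile a c = updateAt (λ _ → 0) a (λ _ → c)

ones : Distribution n
ones _ = 1

updateAt-mono : ∀ {D E : Distribution n} a {f : ℕ → ℕ} → (∀ {k l} → k ≤ l → f k ≤ f l) →
                D ≤ᵈ E → updateAt D a f ≤ᵈ updateAt E a f
updateAt-mono {D = D} {E} a f-mono D≤E i with i ≟ a
... | yes refl = subst₂ _≤_ (≡.sym (updateAt-updates i D)) (≡.sym (updateAt-updates i E)) (f-mono (D≤E i))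
... | no i≢a = subst₂ _≤_ (≡.sym (updateAt-minimal i a D i≢a)) (≡.sym (updateAt-minimal i a E i≢a)) (D≤E i)

updateAt-≤ᵈ : ∀ (D : Distribution n) a {f : ℕ → ℕ} → (∀ k → f k ≤ k) → updateAt D a f ≤ᵈ D
updateAt-≤ᵈ D a f≤ i with i ≟ a
... | yes refl = subst (_≤ D i) (≡.sym (updateAt-updates i D)) (f≤ (D i))
... | no i≢a = ≤-reflexive (updateAt-minimal i a D i≢a)

≤ᵈ-updateAt : ∀ (D : Distribution n) a {f : ℕ → ℕ} → (∀ k → k ≤ f k) → D ≤ᵈ updateAt D a f
≤ᵈ-updateAt D a f≥ i with i ≟ a
... | yes refl = subst (D i ≤_) (≡.sym (updateAt-updates i D)) (f≥ (D i))
... | no i≢a = ≤-reflexive (≡.sym (updateAt-minimal i a D i≢a))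

removePebble-≤ᵈ : ∀ (D : Distribution n) v → removePebble D v ≤ᵈ D
removePebble-≤ᵈ D v = updateAt-≤ᵈ D v (λ k → m∸n≤m k 1)

pile-occupied : ∀ {a i : Fin n} {c} → 1 ≤ pile a c i → i ≡ a
pile-occupied {a = a} {i} occ with i ≟ a
... | yes i≡a = i≡a
... | no i≢a = contradiction (subst (1 ≤_) (updateAt-minimal i a _ i≢a) occ) 1+n≰n

updateAt-+ˡ : ∀ {F D X : Distribution n} a {f g : ℕ → ℕ} → F ≗ zipWith _+_ D X →
              f (F a) ≡ g (D a) + X a → updateAt F a f ≗ zipWith _+_ (updateAt D a g) X
updateAt-+ˡ {F = F} {D} a F≗ eq i with i ≟ a
... | yes refl = ≡.trans (updateAt-updates i F) (≡.trans eq (cong (_+ _) (≡.sym (updateAt-updates i D))))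
... | no i≢a = ≡.trans (updateAt-minimal i a F i≢a)
                 (≡.trans (F≗ i) (cong (_+ _) (≡.sym (updateAt-minimal i a D i≢a))))

updateAt-+ʳ : ∀ {F D X : Distribution n} a {f g : ℕ → ℕ} → F ≗ zipWith _+_ D X →
              f (F a) ≡ D a + g (X a) → updateAt F a f ≗ zipWith _+_ D (updateAt X a g)
updateAt-+ʳ {F = F} {X = X} a F≗ eq i with i ≟ a
... | yes refl = ≡.trans (updateAt-updates i F) (≡.trans eq (cong (_ +_) (≡.sym (updateAt-updates i X))))
... | no i≢a = ≡.trans (updateAt-minimal i a F i≢a)
                 (≡.trans (F≗ i) (cong (_ +_) (≡.sym (updateAt-minimal i a X i≢a))))

pebble-source : ∀ (E : Distribution n) {a b} → a ≢ b → pebble E a b a ≡ E a ∸ 2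
pebble-source E {a} {b} a≢b = ≡.trans (updateAt-minimal a b _ a≢b) (updateAt-updates a E)

pebble-target : ∀ (E : Distribution n) {a b} → a ≢ b → pebble E a b b ≡ suc (E b)
pebble-target E {a} {b} a≢b =
  ≡.trans (updateAt-updates b _) (cong suc (updateAt-minimal b a E (a≢b ∘ ≡.sym)))

pebble-mono : ∀ {D E : Distribution n} a b → D ≤ᵈ E → pebble D a b ≤ᵈ pebble E a b
pebble-mono a b = updateAt-mono b s≤s ∘ updateAt-mono a (∸-monoˡ-≤ 2)

size-cong : ∀ {D E : Distribution n} → D ≗ E → size D ≡ size E
size-cong {zero} _ = refl
size-cong {suc n} D≗E = cong₂ _+_ (D≗E zero) (size-cong (D≗E ∘ suc))

size-mono : ∀ {D E : Distribution n} → D ≤ᵈ E → size D ≤ size E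
size-mono {zero} _ = z≤n
size-mono {suc n} D≤E = +-mono-≤ (D≤E zero) (size-mono (D≤E ∘ suc))

size-replicate : ∀ n c → size {n} (λ _ → c) ≡ n * c
size-replicate zero c = refl
size-replicate (suc n) c = cong (c +_) (size-replicate n c)

size-except : ∀ {D E : Distribution n} a → (∀ i → i ≢ a → E i ≡ D i) →
              size E + D a ≡ size D + E a
size-except {suc n} {D} {E} zero agree = begin
  E zero + size (tail E) + D zero   ≡⟨ cong (λ s → E zero + s + D zero) (size-cong λ i → agree (suc i) λ ()) ⟩
  E zero + size (tail D) + D zero   ≡⟨ +-comm _ (D zero) ⟩
  D zero + (E zero + size (tail D)) ≡⟨ cong (D zero +_) (+-comm (E zero) _) ⟩
  D zero + (size (tail D) + E zero) ≡⟨ +-assoc (D zero) _ _ ⟨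
  D zero + size (tail D) + E zero   ∎
  where open ≡.≡-Reasoning
size-except {suc n} {D} {E} (suc a) agree = begin
  E zero + size (tail E) + D (suc a)   ≡⟨ +-assoc (E zero) _ _ ⟩
  E zero + (size (tail E) + D (suc a)) ≡⟨ cong₂ _+_ (agree zero λ ()) (size-except a agree′) ⟩
  D zero + (size (tail D) + E (suc a)) ≡⟨ +-assoc (D zero) _ _ ⟨
  D zero + size (tail D) + E (suc a)   ∎
  where
  agree′ : ∀ i → i ≢ a → E (suc i) ≡ D (suc i)
  agree′ i i≢a = agree (suc i) (i≢a ∘ Fin-suc-injective)
  open ≡.≡-Reasoning

size-updateAt : ∀ (D : Distribution n) a f → size (updateAt D a f) + D a ≡ size D + f (D a)
size-updateAt D a f = ≡.trans (size-except a λ i i≢a → updateAt-minimal i a D i≢a)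
                              (cong (size D +_) (updateAt-updates a D))

size-addPebble : ∀ (D : Distribution n) v → size (addPebble D v) ≡ suc (size D)
size-addPebble D v = +-cancelʳ-≡ (D v) _ _ (≡.trans (size-updateAt D v suc) (+-suc (size D) (D v)))

size-removePebble : ∀ (D : Distribution n) v → 1 ≤ D v → suc (size (removePebble D v)) ≡ size D
size-removePebble D v occ = +-cancelʳ-≡ (D v ∸ 1) _ _ (begin
  suc (size (removePebble D v)) + (D v ∸ 1) ≡⟨ +-suc _ (D v ∸ 1) ⟨
  size (removePebble D v) + (1 + (D v ∸ 1)) ≡⟨ cong (size (removePebble D v) +_) (m+[n∸m]≡n occ) ⟩
  size (removePebble D v) + D v             ≡⟨ size-updateAt D v (_∸ 1) ⟩
  size D + (D v ∸ 1)                        ∎)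
  where open ≡.≡-Reasoning

size-pile : ∀ (a : Fin n) c → size (pile a c) ≡ c
size-pile {n} a c = begin
  size (pile a c)        ≡⟨ +-identityʳ _ ⟨
  size (pile a c) + 0    ≡⟨ size-updateAt (λ _ → 0) a (λ _ → c) ⟩
  size {n} (λ _ → 0) + c ≡⟨ cong (_+ c) (≡.trans (size-replicate n 0) (*-zeroʳ n)) ⟩
  c                      ∎
  where open ≡.≡-Reasoning

size-ones : size (ones {n}) ≡ n
size-ones {n} = ≡.trans (size-replicate n 1) (*-identityʳ n)

≤-size : ∀ (D : Distribution n) a → D a ≤ size D
≤-size D a = subst (D a ≤_) (≡.trans (size-updateAt D a (λ _ → 0)) (+-identityʳ (size D)))
                   (m≤n+m (D a) _)

occupied-of-positive : ∀ (D : Distribution n) → 1 ≤ size D → ∃ λ v → 1 ≤ D v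
occupied-of-positive {zero} D ()
occupied-of-positive {suc n} D pos with D zero ≤? 0
... | no D₀≰0 = zero , ≰⇒> D₀≰0
... | yes D₀≤0 =
  let (v , occ) = occupied-of-positive (tail D) (subst (1 ≤_) (cong (_+ size (tail D)) (n≤0⇒n≡0 D₀≤0)) pos)
  in suc v , occ

subdistribution-of-size : ∀ (D : Distribution n) k → k ≤ size D → ∃ λ E → E ≤ᵈ D × size E ≡ k
subdistribution-of-size {zero} D zero _ = D , (λ ()) , refl
subdistribution-of-size {suc n} D k k≤ with k ≤? size (tail D)
... | yes k≤tail =
  let (E , E≤ , size-E) = subdistribution-of-size (tail D) k k≤tail
  in (λ { zero → 0 ; (suc i) → E i }) , (λ { zero → z≤n ; (suc i) → E≤ i }) , size-E
... | no k≰tail =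
  (λ { zero → k ∸ size (tail D) ; (suc i) → D (suc i) }) ,
  (λ { zero → subst (k ∸ size (tail D) ≤_) (m+n∸n≡m (D zero) (size (tail D))) (∸-monoˡ-≤ (size (tail D)) k≤)
     ; (suc i) → ≤-refl }) ,
  m∸n+n≡m (<⇒≤ (≰⇒> k≰tail))

-- Weights

weight : (Fin n → ℕ) → Distribution n → ℕ
weight h E = size (λ i → E i * 2 ^ h i)

weight-updateAt : ∀ h (E : Distribution n) a f →
                  weight h (updateAt E a f) + E a * 2 ^ h a ≡ weight h E + f (E a) * 2 ^ h a
weight-updateAt h E a f =
  ≡.trans (size-except a λ i i≢a → cong (_* 2 ^ h i) (updateAt-minimal i a E i≢a))
          (cong (λ k → weight h E + k * 2 ^ h a) (updateAt-updates a E))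

weight-addPebble : ∀ h (E : Distribution n) b → weight h (addPebble E b) ≡ weight h E + 2 ^ h b
weight-addPebble h E b = +-cancelʳ-≡ (E b * 2 ^ h b) _ _
  (≡.trans (weight-updateAt h E b suc) (≡.sym (+-assoc (weight h E) (2 ^ h b) _)))

weight-remove-two : ∀ h (E : Distribution n) a → 2 ≤ E a →
                    weight h (updateAt E a (_∸ 2)) + 2 * 2 ^ h a ≡ weight h E
weight-remove-two h E a two = +-cancelʳ-≡ ((E a ∸ 2) * 2 ^ h a) _ _ (begin
  weight h M + 2 * 2 ^ h a + (E a ∸ 2) * 2 ^ h a   ≡⟨ +-assoc (weight h M) _ _ ⟩
  weight h M + (2 * 2 ^ h a + (E a ∸ 2) * 2 ^ h a) ≡⟨ cong (weight h M +_) (*-distribʳ-+ (2 ^ h a) 2 (E a ∸ 2)) ⟨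
  weight h M + (2 + (E a ∸ 2)) * 2 ^ h a           ≡⟨ cong (λ k → weight h M + k * 2 ^ h a) (m+[n∸m]≡n two) ⟩
  weight h M + E a * 2 ^ h a                       ≡⟨ weight-updateAt h E a (_∸ 2) ⟩
  weight h E + (E a ∸ 2) * 2 ^ h a                 ∎)
  where
  M = updateAt E a (_∸ 2)
  open ≡.≡-Reasoning

weight-pebble : ∀ h (E : Distribution n) {a b} → h b ≤ suc (h a) → 2 ≤ E a →
                weight h (pebble E a b) ≤ weight h E
weight-pebble h E {a} {b} hb≤ two = begin
  weight h (pebble E a b)        ≡⟨ weight-addPebble h M b ⟩
  weight h M + 2 ^ h b           ≤⟨ +-monoʳ-≤ (weight h M) (^-monoʳ-≤ 2 hb≤) ⟩
  weight h M + 2 * 2 ^ h a       ≡⟨ weight-remove-two h E a two ⟩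
  weight h E                     ∎
  where
  M = updateAt E a (_∸ 2)
  open ≤-Reasoning

weight-pile : ∀ h (a : Fin n) c → weight h (pile a c) ≡ c * 2 ^ h a
weight-pile {n} h a c = begin
  weight h (pile a c)              ≡⟨ +-identityʳ _ ⟨
  weight h (pile a c) + 0          ≡⟨ weight-updateAt h (λ _ → 0) a (λ _ → c) ⟩
  size {n} (λ _ → 0) + c * 2 ^ h a ≡⟨ cong (_+ _) (≡.trans (size-replicate n 0) (*-zeroʳ n)) ⟩
  c * 2 ^ h a                      ∎
  where open ≡.≡-Reasoning

-- Pebbling on a graph

module _ {n} (G : Graph n) where

  private
    variable
      a b c i u v w x r : Fin n
      D D′ E F : Distribution n

  adj⇒≢ : Adj G a b → a ≢ b
  adj⇒≢ adj refl = irrefl G adj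

  walk-snoc : Walk G u a k → Adj G a b → Walk G u b (suc k)
  walk-snoc here adj = step adj here
  walk-snoc (step adj′ walk) adj = step adj′ (walk-snoc walk adj)

  ¬¬-distance : Connected G → ∀ u v → ¬ ¬ ∃ (IsDistance G u v)
  ¬¬-distance conn u v = ¬¬-minimum (Walk G u v) (proj₂ (conn u v))

  pebble-step : Adj G a b → 2 ≤ D a → Reachable G D (pebble D a b)
  pebble-step adj two = (_ , _ , adj , two , refl) ◅ ε

  occupied⇒RootSolvable : 1 ≤ D r → RootSolvable G r D
  occupied⇒RootSolvable occ = _ , ε , occ

  RootSolvable-reachable : Reachable G D E → RootSolvable G r E → RootSolvable G r D
  RootSolvable-reachable R (F , R′ , occ) = F , R ◅◅ R′ , occ

  reachable-mono : Reachable G D E → D ≤ᵈ D′ → ∃ λ E′ → Reachable G D′ E′ × E ≤ᵈ E′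
  reachable-mono ε D≤D′ = _ , ε , D≤D′
  reachable-mono ((a , b , adj , two , refl) ◅ steps) D≤D′ =
    let (E′ , R , E≤E′) = reachable-mono steps (pebble-mono a b D≤D′)
    in E′ , (a , b , adj , ≤-trans two (D≤D′ a) , refl) ◅ R , E≤E′

  RootSolvable-mono : D ≤ᵈ D′ → RootSolvable G r D → RootSolvable G r D′
  RootSolvable-mono {r = r} D≤D′ (E , R , occ) =
    let (E′ , R′ , E≤E′) = reachable-mono R D≤D′ in E′ , R′ , ≤-trans occ (E≤E′ r)

  Solvable-mono : D ≤ᵈ D′ → Solvable G D → Solvable G D′
  Solvable-mono D≤D′ solvable r = RootSolvable-mono D≤D′ (solvable r)

  sparse⇒¬RootSolvable : (∀ i → D i ≤ 1) → D r ≡ 0 → ¬ RootSolvable G r D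
  sparse⇒¬RootSolvable sparse empty (_ , ε , occ) = 1+n≰n (subst (1 ≤_) empty occ)
  sparse⇒¬RootSolvable sparse empty (_ , (a , _ , _ , two , _) ◅ _ , _) = 1+n≰n (≤-trans two (sparse a))

  ones-but-¬RootSolvable : ∀ x → ¬ RootSolvable G x (removePebble ones x)
  ones-but-¬RootSolvable x =
    sparse⇒¬RootSolvable (removePebble-≤ᵈ ones x) (updateAt-updates x ones)

  transfer : Adj G c w → ∀ m → m + m ≤ E c → ∃ λ E′ → Reachable G E E′ × m + E w ≤ E′ w
  transfer adj zero _ = _ , ε , ≤-refl
  transfer {c = c} {w} {E} adj (suc m) enough =
    let (E′ , R , gained) = transfer adj m rest
    in E′ , pebble-step adj (≤-trans (s≤s (s≤s z≤n)) enough′) ◅◅ R ,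
       subst (_≤ E′ w) (≡.trans (cong (m +_) (pebble-target E (adj⇒≢ adj))) (+-suc m (E w))) gained
    where
    enough′ : 2 + (m + m) ≤ E c
    enough′ = subst (_≤ E c) (cong suc (+-suc m m)) enough
    rest : m + m ≤ pebble E c w c
    rest = subst (m + m ≤_) (≡.sym (pebble-source E (adj⇒≢ adj))) (∸-monoˡ-≤ 2 enough′)

  RootSolvable-walk : Walk G c x k → 2 ^ k ≤ E c → RootSolvable G x E
  RootSolvable-walk here enough = occupied⇒RootSolvable enough
  RootSolvable-walk {c = c} {k = suc k} {E} (step {w = w} adj walk) enough =
    let (E′ , R , gained) = transfer adj (2 ^ k) (subst (_≤ E c) (cong (2 ^ k +_) (+-identityʳ (2 ^ k))) enough)
    in RootSolvable-reachable R (RootSolvable-walk walk (≤-trans (m≤m+n (2 ^ k) (E w)) gained))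

  -- Pushing two pebbles along a shortest path, each step leaves its source empty; the
  -- source is then farther from x than the rest of the path, so the invariant survives.
  RootSolvable-geodesic : IsDistance G c x k → 2 ≤ E c →
                          (∀ y → y ≢ x → ∀ j → j < k → Walk G y x j → 1 ≤ E y) →
                          RootSolvable G x E
  RootSolvable-geodesic {k = zero} (here , _) two _ = occupied⇒RootSolvable (≤-trans (s≤s z≤n) two)
  RootSolvable-geodesic {c = c} {x} {suc k} {E} (step {w = w} adj walk , shortest) two occupied
    with w ≟ x
  ... | yes refl = RootSolvable-reachable (pebble-step adj two)
                     (occupied⇒RootSolvable (subst (1 ≤_) (≡.sym (pebble-target E (adj⇒≢ adj))) (s≤s z≤n)))
  ... | no w≢x = RootSolvable-reachable (pebble-step adj two) (RootSolvable-geodesic geodesic two′ occupied′)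
    where
    geodesic : IsDistance G w x k
    geodesic = walk , λ m walk′ → ≤-pred (shortest (suc m) (step adj walk′))
    two′ : 2 ≤ pebble E c w w
    two′ = subst (2 ≤_) (≡.sym (pebble-target E (adj⇒≢ adj))) (s≤s (occupied w w≢x k ≤-refl walk))
    occupied′ : ∀ y → y ≢ x → ∀ j → j < k → Walk G y x j → 1 ≤ pebble E c w y
    occupied′ y y≢x j j<k walk′ with y ≟ c
    ... | yes refl = contradiction (≤-trans (shortest j walk′) (<⇒≤ j<k)) 1+n≰n
    ... | no y≢c = ≤-trans (occupied y y≢x j (m≤n⇒m≤1+n j<k) walk′)
                           (≤-trans (≤-reflexive (≡.sym (updateAt-minimal y c E y≢c)))
                                    (≤ᵈ-updateAt (updateAt E c (_∸ 2)) w n≤1+n y))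

  Lipschitz : (Fin n → ℕ) → Set
  Lipschitz h = ∀ {a b} → Adj G a b → h b ≤ suc (h a)

  weight-reachable : ∀ {h} → Lipschitz h → Reachable G D E → weight h E ≤ weight h D
  weight-reachable lip ε = ≤-refl
  weight-reachable {D = D} {h = h} lip ((_ , _ , adj , two , refl) ◅ steps) =
    ≤-trans (weight-reachable lip steps) (weight-pebble h D (lip adj) two)

  weight<⇒¬RootSolvable : ∀ {h} → Lipschitz h → weight h D < 2 ^ h r → ¬ RootSolvable G r D
  weight<⇒¬RootSolvable {D = D} {r} {h} lip light (E , R , occ) = 1+n≰n (begin
    suc (weight h D)   ≤⟨ light ⟩
    2 ^ h r            ≡⟨ *-identityˡ (2 ^ h r) ⟨
    1 * 2 ^ h r        ≤⟨ *-monoˡ-≤ (2 ^ h r) occ ⟩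
    E r * 2 ^ h r      ≤⟨ ≤-size (λ i → E i * 2 ^ h i) r ⟩
    weight h E         ≤⟨ weight-reachable lip R ⟩
    weight h D         ∎)
    where open ≤-Reasoning

  distance-lipschitz : (dist : ∀ y → ∃ (IsDistance G u y)) → Lipschitz (proj₁ ∘ dist)
  distance-lipschitz dist {a} adj = proj₂ (proj₂ (dist _)) _ (walk-snoc (proj₁ (proj₂ (dist a))) adj)

  pile-minimallyRootSolvable : Connected G → IsDistance G u v k →
                               MinimallyRootSolvable G v (pile u (2 ^ k))
  pile-minimallyRootSolvable {u = u} {v} {k} conn (walk , shortest) =
    RootSolvable-walk walk (≤-reflexive (≡.sym (updateAt-updates u _))) , minimal
    where
    minimal : ∀ x → 1 ≤ pile u (2 ^ k) x → ¬ RootSolvable G v (removePebble (pile u (2 ^ k)) x)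
    minimal x occ solvable with pile-occupied {a = u} {x} occ
    ... | refl = ¬¬-Π-Fin (¬¬-distance conn u) λ dist →
      let h = proj₁ ∘ dist
          hu≡0 : h u ≡ 0
          hu≡0 = n≤0⇒n≡0 (proj₂ (proj₂ (dist u)) 0 here)
          light : weight h (pile u (2 ^ k ∸ 1)) < 2 ^ h v
          light = begin-strict
            weight h (pile u (2 ^ k ∸ 1)) ≡⟨ weight-pile h u (2 ^ k ∸ 1) ⟩
            (2 ^ k ∸ 1) * 2 ^ h u         ≡⟨ cong (λ e → (2 ^ k ∸ 1) * 2 ^ e) hu≡0 ⟩
            (2 ^ k ∸ 1) * 1               ≡⟨ *-identityʳ _ ⟩
            2 ^ k ∸ 1                     <⟨ ∸-monoʳ-< {o = 0} (s≤s z≤n) (m^n>0 2 k) ⟩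
            2 ^ k                         ≤⟨ ^-monoʳ-≤ 2 (shortest (h v) (proj₁ (proj₂ (dist v)))) ⟩
            2 ^ h v                       ∎
      in weight<⇒¬RootSolvable (distance-lipschitz dist) light
           (RootSolvable-mono (≤-reflexive ∘ updateAt-updateAt u (λ _ → 0)) solvable)
      where open ≤-Reasoning

  module Stranded (D X : Distribution n) (X≤1 : ∀ i → X i ≤ 1)
                  (X-unreached : ∀ i → 1 ≤ X i → ¬ RootSolvable G i D) where

    source-unstranded : Reachable G D D′ → F ≗ zipWith _+_ D′ X → 2 ≤ F a → X a ≡ 0
    source-unstranded {D′ = D′} {F} {a} R F≗ two = n≤0⇒n≡0 (≮⇒≥ λ occ → 1+n≰n (begin
      2             ≤⟨ two ⟩
      F a           ≡⟨ F≗ a ⟩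
      D′ a + X a    ≤⟨ +-mono-≤ (≮⇒≥ λ occ′ → X-unreached a occ (D′ , R , occ′)) (X≤1 a) ⟩
      1             ∎))
      where open ≤-Reasoning

    reachable-strip : Reachable G F E → Reachable G D D′ → F ≗ zipWith _+_ D′ X →
                      ∃ λ E′ → Reachable G D E′ × E ≗ zipWith _+_ E′ X
    reachable-strip ε R F≗ = _ , R , F≗
    reachable-strip {F = F} {D′ = D′} ((a , b , adj , two , refl) ◅ steps) R F≗ =
      reachable-strip steps (R ◅◅ pebble-step adj two′) pebble≗
      where
      Xa≡0 : X a ≡ 0
      Xa≡0 = source-unstranded R F≗ two
      Fa≡D′a : F a ≡ D′ a
      Fa≡D′a = ≡.trans (F≗ a) (≡.trans (cong (D′ a +_) Xa≡0) (+-identityʳ (D′ a)))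
      two′ : 2 ≤ D′ a
      two′ = subst (2 ≤_) Fa≡D′a two
      pebble≗ : pebble F a b ≗ zipWith _+_ (pebble D′ a b) X
      pebble≗ = updateAt-+ˡ b taken≗ (cong suc (taken≗ b))
        where
        taken≗ : updateAt F a (_∸ 2) ≗ zipWith _+_ (updateAt D′ a (_∸ 2)) X
        taken≗ = updateAt-+ˡ a F≗ (≡.trans (cong (_∸ 2) Fa≡D′a)
                                   (≡.sym (≡.trans (cong ((D′ a ∸ 2) +_) Xa≡0) (+-identityʳ _))))

    RootSolvable-strip : F ≗ zipWith _+_ D X → X r ≡ 0 → RootSolvable G r F → RootSolvable G r D
    RootSolvable-strip {r = r} F≗ Xr≡0 (E , R , occ) =
      let (E′ , R′ , E≗) = reachable-strip R ε F≗
      in E′ , R′ , subst (1 ≤_) (≡.trans (E≗ r) (≡.trans (cong (E′ r +_) Xr≡0) (+-identityʳ _))) occ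

  module Completion {r D} (minimal : MinimallyRootSolvable G r D)
                    (reached? : ∀ i → Dec (RootSolvable G i D)) where

    unreached : Distribution n
    unreached i = if does (reached? i) then 0 else 1

    completion : Distribution n
    completion = zipWith _+_ D unreached

    unreached≤1 : ∀ i → unreached i ≤ 1
    unreached≤1 i with reached? i
    ... | yes _ = z≤n
    ... | no _ = ≤-refl

    unreached-correct : ∀ i → 1 ≤ unreached i → ¬ RootSolvable G i D
    unreached-correct i occ with reached? i
    ... | yes _ = contradiction occ 1+n≰n
    ... | no unsolvable = unsolvable

    unreached≡1 : ¬ RootSolvable G i D → unreached i ≡ 1
    unreached≡1 {i} unsolvable with reached? i
    ... | yes solvable = contradiction solvable unsolvable
    ... | no _ = refl

    reached⇒unreached≡0 : RootSolvable G i D → unreached i ≡ 0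
    reached⇒unreached≡0 {i} solvable with reached? i
    ... | yes _ = refl
    ... | no unsolvable = contradiction solvable unsolvable

    solvable : Solvable G completion
    solvable i with reached? i
    ... | yes solvable = RootSolvable-mono (λ j → m≤m+n (D j) _) solvable
    ... | no unsolvable =
      occupied⇒RootSolvable (subst (λ k → 1 ≤ D i + k) (≡.sym (unreached≡1 unsolvable)) (m≤n+m 1 (D i)))

    minimallySolvable : MinimallySolvable G completion
    minimallySolvable = solvable , λ x occ solvable′ → removing x occ (solvable′ r) (solvable′ x)
      where
      removing : ∀ x → 1 ≤ completion x → RootSolvable G r (removePebble completion x) →
                 RootSolvable G x (removePebble completion x) → ⊥
      removing x occ r-solvable x-solvable with reached? x
      ... | yes _ = proj₂ minimal x occD (Stranded.RootSolvable-strip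
              (removePebble D x) unreached unreached≤1 unreached-correct′ removed≗
              (reached⇒unreached≡0 (proj₁ minimal)) r-solvable)
        where
        -- the with-abstraction has already turned unreached x into 0 in the type of occ
        occD : 1 ≤ D x
        occD = subst (1 ≤_) (+-identityʳ (D x)) occ
        unreached-correct′ : ∀ i → 1 ≤ unreached i → ¬ RootSolvable G i (removePebble D x)
        unreached-correct′ i occ′ = unreached-correct i occ′ ∘ RootSolvable-mono (removePebble-≤ᵈ D x)
        removed≗ : removePebble completion x ≗ zipWith _+_ (removePebble D x) unreached
        removed≗ = updateAt-+ˡ x (λ _ → refl) (+-∸-comm (unreached x) occD)
      ... | no x-unreached = x-unreached (Stranded.RootSolvable-strip
              D unreached′ unreached′≤1 unreached′-correct removed≗ unreached′-x x-solvable)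
        where
        occX : 1 ≤ unreached x
        occX = ≤-reflexive (≡.sym (unreached≡1 x-unreached))
        unreached′ : Distribution n
        unreached′ = removePebble unreached x
        unreached′≤1 : ∀ i → unreached′ i ≤ 1
        unreached′≤1 i = ≤-trans (removePebble-≤ᵈ unreached x i) (unreached≤1 i)
        unreached′-correct : ∀ i → 1 ≤ unreached′ i → ¬ RootSolvable G i D
        unreached′-correct i occ′ = unreached-correct i (≤-trans occ′ (removePebble-≤ᵈ unreached x i))
        unreached′-x : unreached′ x ≡ 0
        unreached′-x = ≡.trans (updateAt-updates x unreached) (cong (_∸ 1) (unreached≡1 x-unreached))
        removed≗ : removePebble completion x ≗ zipWith _+_ D unreached′
        removed≗ = updateAt-+ʳ x (λ _ → refl) (+-∸-assoc (D x) occX)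

  ¬¬minimallySolvable-≥ : MinimallyRootSolvable G r D →
                          ¬ ¬ ∃ λ F → MinimallySolvable G F × size D ≤ size F
  ¬¬minimallySolvable-≥ {D = D} minimal = do
    reached? ← ¬¬-Π-Fin (λ i → ¬¬-excluded-middle)
    let open Completion minimal reached?
    pure (completion , minimallySolvable , size-mono λ i → m≤m+n (D i) _)

  ¬¬minimallySolvable-≤ : Solvable G D → ¬ ¬ ∃ λ D₀ → MinimallySolvable G D₀ × size D₀ ≤ size D
  ¬¬minimallySolvable-≤ {D = D} solvable = do
    (_ , (D₀ , solvable₀ , refl) , least) ← ¬¬-minimum SolvableOfSize (D , solvable , refl)
    let minimal : ∀ v → 1 ≤ D₀ v → Unsolvable G (removePebble D₀ v)
        minimal v occ solvable′ = 1+n≰n (begin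
          suc (size (removePebble D₀ v)) ≡⟨ size-removePebble D₀ v occ ⟩
          size D₀                        ≤⟨ least _ (removePebble D₀ v , solvable′ , refl) ⟩
          size (removePebble D₀ v)       ∎)
    pure (D₀ , (solvable₀ , minimal) , least _ (D , solvable , refl))
    where
    SolvableOfSize : ℕ → Set
    SolvableOfSize s = ∃ λ E → Solvable G E × size E ≡ s
    open ≤-Reasoning

  optimal≤size : ∀ {o} → IsOptimalPebblingNumber G o → ¬ ¬ Solvable G D → o ≤ size D
  optimal≤size (_ , least) ¬¬solvable = decidable-stable (_ ≤? _) do
    solvable ← ¬¬solvable
    (D₀ , minimal , D₀≤D) ← ¬¬minimallySolvable-≤ solvable
    pure (≤-trans (least _ (D₀ , minimal , refl)) D₀≤D)

  ones-minimallySolvable : MinimallySolvable G ones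
  ones-minimallySolvable =
    (λ _ → occupied⇒RootSolvable ≤-refl) , λ x _ solvable → ones-but-¬RootSolvable x (solvable x)

  ¬¬ones-but-maximallyUnsolvable : Connected G → ∀ u → ¬ ¬ MaximallyUnsolvable G (removePebble ones u)
  ¬¬ones-but-maximallyUnsolvable conn u = do
    dist ← ¬¬-Π-Fin (λ w → ¬¬-distance conn w u)
    pure ((λ solvable → ones-but-¬RootSolvable u (solvable u)) , λ w → solvable-after w (dist w))
    where
    D₀ : Distribution n
    D₀ = removePebble ones u
    one-elsewhere : ∀ w i → i ≢ u → 1 ≤ addPebble D₀ w i
    one-elsewhere w i i≢u = ≤-trans (≤-reflexive (≡.sym (updateAt-minimal i u ones i≢u)))
                                    (≤ᵈ-updateAt D₀ w n≤1+n i)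
    solvable-after : ∀ w → ∃ (IsDistance G w u) → Solvable G (addPebble D₀ w)
    solvable-after w (_ , geodesic) r with r ≟ u
    ... | no r≢u = occupied⇒RootSolvable (one-elsewhere w r r≢u)
    ... | yes refl with w ≟ r
    ...   | yes refl = occupied⇒RootSolvable (subst (1 ≤_) (≡.sym (updateAt-updates r D₀)) (s≤s z≤n))
    ...   | no w≢r = RootSolvable-geodesic geodesic
                       (subst (2 ≤_) (≡.sym (updateAt-updates w D₀))
                              (s≤s (≤-reflexive (≡.sym (updateAt-minimal w r ones w≢r)))))
                       (λ y y≢r _ _ _ → one-elsewhere w y y≢r)

  pebblingNumber-sufficient : ∀ {p} → IsPebblingNumber G p → p ≤ size D → Solvable G D
  pebblingNumber-sufficient {D = D} {p} (enough , _) p≤ =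
    let (E , E≤D , size-E) = subdistribution-of-size D p p≤
    in Solvable-mono E≤D (enough E size-E)

  minimallySolvable⇒size≤pebblingNumber : ∀ {p} → IsPebblingNumber G p → MinimallySolvable G D →
                                          size D ≤ p
  minimallySolvable⇒size≤pebblingNumber {D = D} {p} pebbling (_ , minimal) with size D ≤? p
  ... | yes size≤p = size≤p
  ... | no size≰p =
    let p<size = ≰⇒> size≰p
        (v , occ) = occupied-of-positive D (≤-trans (s≤s z≤n) p<size)
        p≤removed = ≤-pred (subst (p <_) (≡.sym (size-removePebble D v occ)) p<size)
    in contradiction (pebblingNumber-sufficient pebbling p≤removed) (minimal v occ)

  optimal≤2^diameter : ∀ {d o} → Connected G → IsDiameter G d → IsOptimalPebblingNumber G o →
                       o ≤ 2 ^ d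
  optimal≤2^diameter {d} {o} conn ((u , _) , longest) optimal =
    subst (o ≤_) (size-pile u (2 ^ d)) (optimal≤size optimal (¬¬-Π-Fin λ r → do
      (k , walk , shortest) ← ¬¬-distance conn u r
      pure (RootSolvable-walk walk (≤-trans (^-monoʳ-≤ 2 (longest k (u , r , walk , shortest)))
                                            (≤-reflexive (≡.sym (updateAt-updates u _)))))))

  2^diameter≤cr : ∀ {d cr} → Connected G → IsDiameter G d → IsCr G cr → 2 ^ d ≤ cr
  2^diameter≤cr {d} conn ((u , v , diametral) , _) (_ , largest) =
    largest _ (v , pile u (2 ^ d) , pile-minimallyRootSolvable conn diametral , size-pile u (2 ^ d))

  cr≤cg : ∀ {cr cg} → IsCr G cr → IsCg G cg → cr ≤ cg
  cr≤cg ((_ , _ , minimal , refl) , _) (_ , largest) = decidable-stable (_ ≤? _) do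
    (F , minimalF , D≤F) ← ¬¬minimallySolvable-≥ minimal
    pure (≤-trans D≤F (largest _ (F , minimalF , refl)))

  optimal≤cu : ∀ {o cu} → Fin n → IsOptimalPebblingNumber G o → IsCu G cu → o ≤ cu
  optimal≤cu {o} u optimal (_ , ((D , (_ , solvable-after) , refl) , _) , refl) =
    subst (o ≤_) (size-addPebble D u) (optimal≤size optimal (pure (solvable-after u)))

  cu≤order : ∀ {cu} → Connected G → Fin n → IsCu G cu → cu ≤ n
  cu≤order conn u (_ , (_ , least) , refl) = decidable-stable (_ ≤? _) do
    maximal ← ¬¬ones-but-maximallyUnsolvable conn u
    pure (subst (_ ≤_) (≡.trans (size-removePebble ones u ≤-refl) size-ones)
                (s≤s (least _ (removePebble ones u , maximal , refl))))

  order≤cg : ∀ {cg} → IsCg G cg → n ≤ cg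
  order≤cg (_ , largest) = largest n (ones , ones-minimallySolvable , size-ones)

  cg≤pebbling : ∀ {cg p} → IsCg G cg → IsPebblingNumber G p → cg ≤ p
  cg≤pebbling ((_ , minimal , refl) , _) pebbling = minimallySolvable⇒size≤pebblingNumber pebbling minimal

lemma2 : ∀ {n} (G : Graph n) → Connected G → ∀ d → IsDiameter G d →
    ∀ (o cr cg cu p : ℕ) →
    IsOptimalPebblingNumber G o → IsCr G cr → IsCg G cg → IsCu G cu →
    IsPebblingNumber G p →
      (o ≤ 2 ^ d) × (2 ^ d ≤ cr) × (cr ≤ cg) × (o ≤ cu) × (cu ≤ n)
      × (n ≤ cg) × (cg ≤ p)
lemma2 G conn d diameter o cr cg cu p optimal crP cgP cuP pebbling =
  optimal≤2^diameter G conn diameter optimal ,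
  2^diameter≤cr G conn diameter crP ,
  cr≤cg G crP cgP ,
  optimal≤cu G u optimal cuP ,
  cu≤order G conn u cuP ,
  order≤cg G cgP ,
  cg≤pebbling G cgP pebbling
  where
  u = proj₁ (proj₁ diameter)
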